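{- Let $p_k$ be a prime, $p_{k+1}$ the next prime, and write $\mathcal{G}(p_k\#)=(g_1,\dots,g_{\varphi(p_k\#)})$. Then: (R1) $p_{k+1}=g_1+1$. (R2–R3) Let $(h_1,\dots,h_{M})$, $M=p_{k+1}\varphi(p_k\#)$, be the concatenation of $p_{k+1}$ copies of $\mathcal{G}(p_k\#)$, and let $v_m=1+h_1+\dots+h_m$ for $0\le m\le M$ (so the $v_m$ are exactly the integers in $[1,p_{k+1}\#+1]$ coprime to $p_k\#$). For each index $m$ with $1\le m<M$ such that $v_m$ is divisible by $p_{k+1}$, replace the two adjacent entries $h_m,h_{m+1}$ by their sum $h_m+h_{m+1}$ (a "closure"). The resulting sequence is exactly $\mathcal{G}(p_{k+1}\#)$. Moreover the values $v_m$ at which closures are performed are exactly $p_{k+1}\cdot u$ for the integers $u\in[1,p_k\#]$ coprime to $p_k\#$ (the first being $p_{k+1}$ itself), so that, listed in increasing order, consecutive closure values differ by $p_{k+1}g_1,p_{k+1}g_2,\dots$, i.e. by the entries of the elementwise product $p_{k+1}*\mathcal{G}(p_k\#)$.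
   Context: For a prime $p$, $p\#$ denotes the primorial, the product of all primes $\le p$. For a positive integer $N$, let $1=u_0<u_1<\dots<u_{\varphi(N)}=N+1$ be the integers in $[1,N+1]$ coprime to $N$; the cycle of gaps of $N$ is $\mathcal{G}(N)=(g_1,\dots,g_{\varphi(N)})$ with $g_i=u_i-u_{i-1}$. -}

module Defs where

open import Data.Nat using (ℕ; zero; suc; _+_; _*_; _∸_)
open import Data.Nat.Divisibility using (_∣?_)
open import Data.Nat.Primality using (prime?)
open import Data.Nat.Coprimality using (coprime?)
open import Data.List using (List; []; _∷_; filter; upTo; map; applyUpTo)
open import Data.Nat.ListAction using (product)
open import Relation.Nullary using (does)
open import Data.Bool using (if_then_else_)

primorial : ℕ → ℕ
primorial p = product (filter prime? (upTo (suc p)))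

coprimesIn : ℕ → ℕ → List ℕ
coprimesIn N K = filter (λ u → coprime? u N) (applyUpTo suc K)

diffs : List ℕ → List ℕ
diffs (x ∷ y ∷ t) = (y ∸ x) ∷ diffs (y ∷ t)
diffs _ = []

gapCycle : ℕ → List ℕ
gapCycle N = diffs (coprimesIn N (suc N))

copies : ℕ → List ℕ → List ℕ
copies zero xs = []
copies (suc c) xs = xs Data.List.++ copies c xs

-- Given q, the running value v = v_{m-1} (before reading h_m),
-- an accumulator acc for the currently merged entry, and the remaining
-- entries h_m, h_{m+1}, …: whenever v_m = v + h_m is divisible by q and
-- h_{m+1} exists (m < M), the boundary between h_m and h_{m+1} is removed
-- (the two adjacent entries are replaced by their sum).
closeAux : ℕ → ℕ → ℕ → List ℕ → List ℕ
closeAux q v acc [] = []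
closeAux q v acc (h ∷ []) = (acc + h) ∷ []
closeAux q v acc (h ∷ h' ∷ t) =
  if does (q ∣? (v + h))
  then closeAux q (v + h) (acc + h) (h' ∷ t)
  else (acc + h) ∷ closeAux q (v + h) 0 (h' ∷ t)

close : ℕ → List ℕ → List ℕ
close q hs = closeAux q 1 0 hs

-- the values v_m (1 ≤ m < M) with q ∣ v_m, in increasing order of m
closureValsAux : ℕ → ℕ → List ℕ → List ℕ
closureValsAux q v (h ∷ h' ∷ t) =
  if does (q ∣? (v + h))
  then (v + h) ∷ closureValsAux q (v + h) (h' ∷ t)
  else closureValsAux q (v + h) (h' ∷ t)
closureValsAux q v _ = []

closureValues : ℕ → List ℕ → List ℕ
closureValues q hs = closureValsAux q 1 hs

-- Write N = p#.  Coprimality to N is N-periodic, so the integers in [1, qN + 1] coprime to N are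
-- q translates of those in [1, N + 1]: their gaps are q copies of 𝒢(N).  Since q is prime and
-- q# = qN, an integer is coprime to q# iff it is coprime to N and not divisible by q; so 𝒢(q#)
-- is obtained by deleting the multiples of q from that list, which on the level of gaps is
-- exactly the closure at each deleted value.  The deleted values are the qu with u coprime to
-- N (q itself being coprime to N), and the first gap of 𝒢(N) is q - 1 because every integer in
-- (1, q) has a prime factor at most p.
module Submission where

open import Defs
open import Data.Nat using (ℕ; _+_; _*_; _<_)
open import Data.Nat.Primality using (Prime)
open import Data.List using (List; []; _∷_; _++_; map; head; scanl)
open import Data.Maybe using (just)
open import Data.Product using (_×_; ∃-syntax)
open import Relation.Binary.PropositionalEquality using (_≡_)
open import Relation.Nullary using (¬_)

open import Data.Nat using (zero; suc; pred; _∸_; _≤_; _≤?_; z≤n; s≤s; z<s; NonZero; >-nonZero; >-nonZero⁻¹; nonTrivial⇒n>1)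
open import Data.Nat.Properties
open import Data.Nat.Divisibility using (_∣_; _∤_; _∣?_; divides; ∣-refl; ∣-trans; m∣m*n; ∣m∣n⇒∣m+n; ∣m+n∣m⇒∣n; ∣n⇒∣m*n; ∣1⇒≡1; ∣⇒≤)
open import Data.Nat.Coprimality using (Coprime; coprime?; coprime-divisor; coprime-+; 1-coprimeTo)
open import Data.Nat.Primality using (prime?; prime⇒irreducible; prime⇒nonZero; prime⇒nonTrivial; ¬prime[1]; productOfPrimes≢0)
open import Data.Nat.Primality.Factorisation using (factorise; factorisationHasAllPrimeFactors)
open import Data.Nat.ListAction using (product)
open import Data.Nat.ListAction.Properties using (∈⇒∣product; product-++)
open import Data.List using (filter; applyUpTo; upTo; _∷ʳ_)
open import Data.List.Properties using (filter-++; filter-accept; filter-reject; filter-≐; map-++; upTo-∷ʳ)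
open import Data.List.Membership.Propositional using (_∈_)
open import Data.List.Membership.Propositional.Properties using (∈-filter⁺; ∈-filter⁻; ∈-map⁺; ∈-map⁻; ∈-upTo⁺; ∈-upTo⁻)
open import Data.List.Relation.Unary.Any using (here; there)
open import Data.List.Relation.Unary.All as All using (All; _∷_)
open import Data.List.Relation.Unary.All.Properties using (all-filter)
open import Data.List.Relation.Unary.AllPairs as AllPairs using (AllPairs; []; _∷_)
import Data.List.Relation.Unary.AllPairs.Properties as AllPairsₚ
open import Data.Product using (_,_; proj₁; proj₂)
open import Data.Sum using (inj₁; inj₂)
open import Data.Empty using (⊥-elim)
open import Data.Bool using (if_then_else_)
open import Function using (_∘_)
open import Relation.Nullary using (yes; no; does)
open import Relation.Unary using (Pred; Decidable; _≐_)
open import Relation.Unary.Properties using (_∩?_; ∁?)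
open import Relation.Binary.PropositionalEquality using (refl; sym; trans; cong; cong₂; subst; subst₂; module ≡-Reasoning)

open ≡-Reasoning

module _ {a b p} {A : Set a} {B : Set b} {P : Pred B p} (P? : Decidable P) where

  filter-map : ∀ (f : A → B) xs → filter P? (map f xs) ≡ map f (filter (P? ∘ f) xs)
  filter-map f []       = refl
  filter-map f (x ∷ xs) with P? (f x)
  ... | yes _ = cong (f x ∷_) (filter-map f xs)
  ... | no  _ = filter-map f xs

module _ {a p q} {A : Set a} {P : Pred A p} {Q : Pred A q} (P? : Decidable P) (Q? : Decidable Q) where

  filter-∩ : ∀ xs → filter (P? ∩? Q?) xs ≡ filter Q? (filter P? xs)
  filter-∩ []       = refl
  filter-∩ (x ∷ xs) with P? x | Q? x
  ... | yes _ | yes Qx  = trans (cong (x ∷_) (filter-∩ xs)) (sym (filter-accept Q? Qx))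
  ... | yes _ | no  ¬Qx = trans (filter-∩ xs) (sym (filter-reject Q? ¬Qx))
  ... | no  _ | _     = filter-∩ xs

Increasing : List ℕ → Set
Increasing = AllPairs _<_

head-< : ∀ {x y ys} → Increasing (x ∷ y ∷ ys) → x < y
head-< ((x<y ∷ _) ∷ _) = x<y

head-≤ : ∀ {x xs z} → Increasing (x ∷ xs) → z ∈ x ∷ xs → x ≤ z
head-≤ _          (here refl) = ≤-refl
head-≤ (x< ∷ _) (there z∈xs) = <⇒≤ (All.lookup x< z∈xs)

⊆-tail : ∀ {x xs ys} → Increasing (x ∷ xs) → (∀ {z} → z ∈ x ∷ xs → z ∈ x ∷ ys) → ∀ {z} → z ∈ xs → z ∈ ys
⊆-tail (x< ∷ _) ⊆ z∈xs with ⊆ (there z∈xs)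
... | here refl   = ⊥-elim (<-irrefl refl (All.lookup x< z∈xs))
... | there z∈ys = z∈ys

increasing-≡ : ∀ {xs ys} → Increasing xs → Increasing ys →
  (∀ {z} → z ∈ xs → z ∈ ys) → (∀ {z} → z ∈ ys → z ∈ xs) → xs ≡ ys
increasing-≡ {[]}     {[]}     _ _ _ _ = refl
increasing-≡ {[]}     {_ ∷ _}  _ _ _ ⊇ with () ← ⊇ (here refl)
increasing-≡ {_ ∷ _}  {[]}     _ _ ⊆ _ with () ← ⊆ (here refl)
increasing-≡ {x ∷ xs} {y ∷ ys} ↗xs ↗ys ⊆ ⊇
  with ≤-antisym (head-≤ ↗ys (⊆ (here refl))) (head-≤ ↗xs (⊇ (here refl)))
... | refl = cong (x ∷_) (increasing-≡ (AllPairs.tail ↗xs) (AllPairs.tail ↗ys) (⊆-tail ↗xs ⊆) (⊆-tail ↗ys ⊇))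

range : ℕ → ℕ → List ℕ
range a zero    = []
range a (suc n) = a ∷ range (suc a) n

∈-range⁻ : ∀ {x} a n → x ∈ range a n → a ≤ x × x < a + n
∈-range⁻ a (suc n) (here refl) = ≤-refl , m<m+n a z<s
∈-range⁻ {x} a (suc n) (there x∈) with ∈-range⁻ (suc a) n x∈
... | a<x , x<1+a+n = <⇒≤ a<x , subst (x <_) (sym (+-suc a n)) x<1+a+n

∈-range⁺ : ∀ {x} a n → a ≤ x → x < a + n → x ∈ range a n
∈-range⁺ {x} a zero a≤x x<a+0 = ⊥-elim (<⇒≱ (subst (x <_) (+-identityʳ a) x<a+0) a≤x)
∈-range⁺ {x} a (suc n) a≤x x<a+1+n with m≤n⇒m<n∨m≡n a≤x
... | inj₂ refl = here refl
... | inj₁ a<x  = there (∈-range⁺ (suc a) n a<x (subst (x <_) (+-suc a n) x<a+1+n))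

range-increasing : ∀ a n → Increasing (range a n)
range-increasing a zero    = []
range-increasing a (suc n) = All.tabulate (proj₁ ∘ ∈-range⁻ (suc a) n) ∷ range-increasing (suc a) n

range-++ : ∀ a m n → range a (m + n) ≡ range a m ++ range (a + m) n
range-++ a zero    n = cong (λ b → range b n) (sym (+-identityʳ a))
range-++ a (suc m) n = cong (a ∷_) (trans (range-++ (suc a) m n) (cong (λ b → range (suc a) m ++ range b n) (sym (+-suc a m))))

range-∷ʳ : ∀ a n → range a (suc n) ≡ range a n ∷ʳ (a + n)
range-∷ʳ a n = trans (cong (range a) (+-comm 1 n)) (range-++ a n 1)

map-+-range : ∀ k a n → map (k +_) (range a n) ≡ range (k + a) n
map-+-range k a zero    = refl
map-+-range k a (suc n) = cong (k + a ∷_) (trans (map-+-range k (suc a) n) (cong (λ b → range b n) (+-suc k a)))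

filter-range-least : ∀ {p} {P : Pred ℕ p} (P? : Decidable P) {a q} n → a ≤ q → q < a + n → P q →
  (∀ {x} → a ≤ x → x < q → ¬ P x) → ∃[ t ] filter P? (range a n) ≡ q ∷ t
filter-range-least P? {a} {q} zero a≤q q<a+0 _ _ = ⊥-elim (<⇒≱ (subst (q <_) (+-identityʳ a) q<a+0) a≤q)
filter-range-least P? {a} {q} (suc n) a≤q q<a+1+n Pq below with m≤n⇒m<n∨m≡n a≤q
... | inj₂ refl = filter P? (range (suc a) n) , filter-accept P? Pq
... | inj₁ a<q
  with t , eq ← filter-range-least P? n a<q (subst (q <_) (+-suc a n) q<a+1+n) Pq (below ∘ <⇒≤)
  = t , trans (filter-reject P? (below ≤-refl a<q)) eq

applyUpTo≡range : ∀ {f : ℕ → ℕ} a n → (∀ i → f i ≡ a + i) → applyUpTo f n ≡ range a n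
applyUpTo≡range a zero    f≗ = refl
applyUpTo≡range a (suc n) f≗ =
  cong₂ _∷_ (trans (f≗ 0) (+-identityʳ a)) (applyUpTo≡range (suc a) n (λ i → trans (f≗ (suc i)) (+-suc a i)))

applyUpTo-suc : ∀ n → applyUpTo suc n ≡ range 1 n
applyUpTo-suc n = applyUpTo≡range 1 n (λ _ → refl)

-- Gap sequences

∸-+-∸ : ∀ {s v b} → s ≤ v → v ≤ b → (v ∸ s) + (b ∸ v) ≡ b ∸ s
∸-+-∸ {s} {v} {b} s≤v v≤b = begin
  (v ∸ s) + (b ∸ v)  ≡⟨ +-comm (v ∸ s) (b ∸ v) ⟩
  (b ∸ v) + (v ∸ s)  ≡⟨ sym (+-∸-assoc (b ∸ v) s≤v) ⟩
  (b ∸ v) + v ∸ s    ≡⟨ cong (_∸ s) (m∸n+n≡m v≤b) ⟩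
  b ∸ s              ∎

diffs-++ : ∀ xs y ys → diffs (xs ++ y ∷ ys) ≡ diffs (xs ∷ʳ y) ++ diffs (y ∷ ys)
diffs-++ []           y ys = refl
diffs-++ (x ∷ [])     y ys = refl
diffs-++ (x ∷ x′ ∷ xs) y ys = cong (x′ ∸ x ∷_) (diffs-++ (x′ ∷ xs) y ys)

diffs-∷ʳ : ∀ x xs y → ∃[ g ] diffs ((x ∷ xs) ∷ʳ y) ≡ diffs (x ∷ xs) ∷ʳ g
diffs-∷ʳ x []        y = y ∸ x , refl
diffs-∷ʳ x (x′ ∷ xs) y with g , eq ← diffs-∷ʳ x′ xs y = g , cong (x′ ∸ x ∷_) eq

diffs-map-+ : ∀ k xs → diffs (map (k +_) xs) ≡ diffs xs
diffs-map-+ k []           = refl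
diffs-map-+ k (x ∷ [])     = refl
diffs-map-+ k (x ∷ y ∷ xs) = cong₂ _∷_ ([m+n]∸[m+o]≡n∸o k y x) (diffs-map-+ k (y ∷ xs))

diffs-map-* : ∀ q xs → diffs (map (q *_) xs) ≡ map (q *_) (diffs xs)
diffs-map-* q []           = refl
diffs-map-* q (x ∷ [])     = refl
diffs-map-* q (x ∷ y ∷ xs) = cong₂ _∷_ (sym (*-distribˡ-∸ q y x)) (diffs-map-* q (y ∷ xs))

diffs-map-*-∷ʳ : ∀ q x xs y → ∃[ g ] diffs (map (q *_) (x ∷ xs)) ∷ʳ g ≡ map (q *_) (diffs (x ∷ xs ∷ʳ y))
diffs-map-*-∷ʳ q x xs y with g , eq ← diffs-∷ʳ (q * x) (map (q *_) xs) (q * y) = g , (begin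
  diffs (map (q *_) (x ∷ xs)) ∷ʳ g       ≡⟨ sym eq ⟩
  diffs (map (q *_) (x ∷ xs) ∷ʳ q * y)   ≡⟨ cong diffs (sym (map-++ (q *_) (x ∷ xs) (y ∷ []))) ⟩
  diffs (map (q *_) (x ∷ xs ∷ʳ y))       ≡⟨ diffs-map-* q (x ∷ xs ∷ʳ y) ⟩
  map (q *_) (diffs (x ∷ xs ∷ʳ y))       ∎)

scanl-diffs : ∀ {a xs} → Increasing (a ∷ xs) → scanl _+_ a (diffs (a ∷ xs)) ≡ a ∷ xs
scanl-diffs {a} {[]}     _              = refl
scanl-diffs {a} {x ∷ xs} ↗@(_ ∷ ↗xs) = cong (a ∷_) (begin
  scanl _+_ (a + (x ∸ a)) (diffs (x ∷ xs))
    ≡⟨ cong (λ b → scanl _+_ b (diffs (x ∷ xs))) (m+[n∸m]≡n (<⇒≤ (head-< ↗))) ⟩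
  scanl _+_ x (diffs (x ∷ xs))
    ≡⟨ scanl-diffs ↗xs ⟩
  x ∷ xs
    ∎)

-- Closures

module _ (q : ℕ) where

  -- diffs of a list with at least two elements is a cons, so closeAux takes a step
  closeAux-step : ∀ v acc h x xs b → closeAux q v acc (h ∷ diffs (x ∷ xs ∷ʳ b)) ≡
    (if does (q ∣? (v + h)) then closeAux q (v + h) (acc + h) (diffs (x ∷ xs ∷ʳ b))
     else acc + h ∷ closeAux q (v + h) 0 (diffs (x ∷ xs ∷ʳ b)))
  closeAux-step v acc h x []      b = refl
  closeAux-step v acc h x (_ ∷ _) b = refl

  closureValsAux-step : ∀ v h x xs b → closureValsAux q v (h ∷ diffs (x ∷ xs ∷ʳ b)) ≡
    (if does (q ∣? (v + h)) then v + h ∷ closureValsAux q (v + h) (diffs (x ∷ xs ∷ʳ b))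
     else closureValsAux q (v + h) (diffs (x ∷ xs ∷ʳ b)))
  closureValsAux-step v h x []      b = refl
  closureValsAux-step v h x (_ ∷ _) b = refl

  -- closeAux keeps as accumulator the distance v ∸ s back to the last value s not closed over
  closeAux-diffs : ∀ {s v} xs b → Increasing (v ∷ xs ∷ʳ b) → s ≤ v → q ∤ b →
    closeAux q v (v ∸ s) (diffs (v ∷ xs ∷ʳ b)) ≡ diffs (s ∷ filter (∁? (q ∣?_)) (xs ∷ʳ b))
  closeAux-diffs {s} {v} [] b ↗ s≤v q∤b = begin
    (v ∸ s) + (b ∸ v) ∷ []                   ≡⟨ cong (_∷ []) (∸-+-∸ s≤v (<⇒≤ (head-< ↗))) ⟩
    b ∸ s ∷ []                               ≡⟨ cong (diffs ∘ (s ∷_)) (sym (filter-accept (∁? (q ∣?_)) q∤b)) ⟩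
    diffs (s ∷ filter (∁? (q ∣?_)) (b ∷ [])) ∎
  closeAux-diffs {s} {v} (w ∷ xs) b ↗@(_ ∷ ↗w) s≤v q∤b
    rewrite closeAux-step v (v ∸ s) (w ∸ v) w xs b | m+[n∸m]≡n (<⇒≤ (head-< ↗)) with q ∣? w
  ... | yes _ = trans (cong (λ acc → closeAux q w acc (diffs (w ∷ xs ∷ʳ b))) (∸-+-∸ s≤v (<⇒≤ (head-< ↗))))
                      (closeAux-diffs xs b ↗w (≤-trans s≤v (<⇒≤ (head-< ↗))) q∤b)
  ... | no  _ = cong₂ _∷_ (∸-+-∸ s≤v (<⇒≤ (head-< ↗)))
                      (trans (cong (λ acc → closeAux q w acc (diffs (w ∷ xs ∷ʳ b))) (sym (n∸n≡0 w)))
                             (closeAux-diffs xs b ↗w ≤-refl q∤b))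

  closureValsAux-diffs : ∀ {v} xs b → Increasing (v ∷ xs ∷ʳ b) →
    closureValsAux q v (diffs (v ∷ xs ∷ʳ b)) ≡ filter (q ∣?_) xs
  closureValsAux-diffs         []       b _ = refl
  closureValsAux-diffs {v} (w ∷ xs) b ↗@(_ ∷ ↗w)
    rewrite closureValsAux-step v (w ∸ v) w xs b | m+[n∸m]≡n (<⇒≤ (head-< ↗)) with q ∣? w
  ... | yes _ = cong (w ∷_) (closureValsAux-diffs xs b ↗w)
  ... | no  _ = closureValsAux-diffs xs b ↗w

  close-diffs : ∀ xs b → Increasing (1 ∷ xs ∷ʳ b) → q ∤ 1 → q ∤ b →
    close q (diffs (1 ∷ xs ∷ʳ b)) ≡ diffs (filter (∁? (q ∣?_)) (1 ∷ xs ∷ʳ b))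
  close-diffs xs b ↗ q∤1 q∤b =
    trans (closeAux-diffs xs b ↗ ≤-refl q∤b) (cong diffs (sym (filter-accept (∁? (q ∣?_)) q∤1)))

  closureValues-diffs : ∀ xs b → Increasing (1 ∷ xs ∷ʳ b) → q ∤ 1 →
    closureValues q (diffs (1 ∷ xs ∷ʳ b)) ≡ filter (q ∣?_) (1 ∷ xs)
  closureValues-diffs xs b ↗ q∤1 = trans (closureValsAux-diffs xs b ↗) (sym (filter-reject (q ∣?_) q∤1))

-- Periodic predicates

module Periodic {p} {P : Pred ℕ p} (P? : Decidable P) (N : ℕ)
                (periodic : ∀ k → (λ x → P (k * N + x)) ≐ P) (P[1] : P 1) where

  window : ℕ → ℕ → List ℕ
  window k c = filter P? (range (suc (k * N)) (suc (c * N)))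

  period : List ℕ
  period = filter P? (range 1 (suc N))

  window-increasing : ∀ k c → Increasing (window k c)
  window-increasing k c = AllPairsₚ.filter⁺ P? (range-increasing _ _)

  P[1+kN] : ∀ k → P (suc (k * N))
  P[1+kN] k = subst P (+-comm (k * N) 1) (proj₂ (periodic k) P[1])

  window-∷ : ∀ k c → window k c ≡ suc (k * N) ∷ filter P? (range (2 + k * N) (c * N))
  window-∷ k c = filter-accept P? (P[1+kN] k)

  window-∷ʳ : ∀ c → window 0 c ≡ filter P? (range 1 (c * N)) ∷ʳ suc (c * N)
  window-∷ʳ c = begin
    filter P? (range 1 (suc (c * N)))
      ≡⟨ cong (filter P?) (range-∷ʳ 1 (c * N)) ⟩
    filter P? (range 1 (c * N) ∷ʳ suc (c * N))
      ≡⟨ filter-++ P? (range 1 (c * N)) _ ⟩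
    filter P? (range 1 (c * N)) ++ filter P? (suc (c * N) ∷ [])
      ≡⟨ cong (filter P? (range 1 (c * N)) ++_) (filter-accept P? (P[1+kN] c)) ⟩
    filter P? (range 1 (c * N)) ∷ʳ suc (c * N)
      ∎

  filter-range-1 : ∀ {n} → 0 < n → filter P? (range 1 n) ≡ 1 ∷ filter P? (range 2 (pred n))
  filter-range-1 {suc n} _ = filter-accept P? P[1]

  period-∷ʳ : period ≡ filter P? (range 1 N) ∷ʳ suc N
  period-∷ʳ = begin
    filter P? (range 1 (suc N))
      ≡⟨ cong (filter P?) (range-∷ʳ 1 N) ⟩
    filter P? (range 1 N ∷ʳ suc N)
      ≡⟨ filter-++ P? (range 1 N) _ ⟩
    filter P? (range 1 N) ++ filter P? (suc N ∷ [])
      ≡⟨ cong (filter P? (range 1 N) ++_) (filter-accept P? P[1+N]) ⟩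
    filter P? (range 1 N) ∷ʳ suc N
      ∎
    where
    P[1+N] : P (suc N)
    P[1+N] = subst (P ∘ suc) (+-identityʳ N) (P[1+kN] 1)

  window-suc : ∀ k c → window k (suc c) ≡ filter P? (range (suc (k * N)) N) ++ window (suc k) c
  window-suc k c = begin
    filter P? (range (suc (k * N)) (suc (N + c * N)))
      ≡⟨ cong (filter P? ∘ range (suc (k * N))) (sym (+-suc N (c * N))) ⟩
    filter P? (range (suc (k * N)) (N + suc (c * N)))
      ≡⟨ cong (filter P?) (range-++ (suc (k * N)) N (suc (c * N))) ⟩
    filter P? (range (suc (k * N)) N ++ range (suc (k * N + N)) (suc (c * N)))
      ≡⟨ filter-++ P? (range (suc (k * N)) N) _ ⟩
    filter P? (range (suc (k * N)) N) ++ filter P? (range (suc (k * N + N)) (suc (c * N)))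
      ≡⟨ cong (λ a → filter P? (range (suc (k * N)) N) ++ filter P? (range (suc a) (suc (c * N)))) (+-comm (k * N) N) ⟩
    filter P? (range (suc (k * N)) N) ++ window (suc k) c
      ∎

  block-∷ʳ : ∀ k → filter P? (range (suc (k * N)) N) ∷ʳ suc (suc k * N) ≡ map (k * N +_) period
  block-∷ʳ k = begin
    filter P? (range (suc (k * N)) N) ∷ʳ suc (suc k * N)
      ≡⟨ cong (λ a → filter P? (range a N) ∷ʳ suc (suc k * N)) (+-comm 1 (k * N)) ⟩
    filter P? (range (k * N + 1) N) ∷ʳ suc (suc k * N)
      ≡⟨ cong (λ xs → filter P? xs ∷ʳ suc (suc k * N)) (sym (map-+-range (k * N) 1 N)) ⟩
    filter P? (map (k * N +_) (range 1 N)) ∷ʳ suc (suc k * N)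
      ≡⟨ cong (_∷ʳ suc (suc k * N)) (filter-map P? (k * N +_) (range 1 N)) ⟩
    map (k * N +_) (filter (P? ∘ (k * N +_)) (range 1 N)) ∷ʳ suc (suc k * N)
      ≡⟨ cong₂ (λ xs a → map (k * N +_) xs ∷ʳ a) (filter-≐ (P? ∘ (k * N +_)) P? (periodic k) (range 1 N)) 1+[1+k]N≡kN+[1+N] ⟩
    map (k * N +_) (filter P? (range 1 N)) ++ map (k * N +_) (suc N ∷ [])
      ≡⟨ sym (map-++ (k * N +_) (filter P? (range 1 N)) (suc N ∷ [])) ⟩
    map (k * N +_) (filter P? (range 1 N) ∷ʳ suc N)
      ≡⟨ cong (map (k * N +_)) (sym period-∷ʳ) ⟩
    map (k * N +_) period
      ∎
    where
    1+[1+k]N≡kN+[1+N] : suc (suc k * N) ≡ k * N + suc N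
    1+[1+k]N≡kN+[1+N] = sym (trans (+-suc (k * N) N) (cong suc (+-comm (k * N) N)))

  diffs-window : ∀ c k → diffs (window k c) ≡ copies c (diffs period)
  diffs-window zero    k = cong diffs (window-∷ k 0)
  diffs-window (suc c) k = begin
    diffs (window k (suc c))
      ≡⟨ cong diffs (window-suc k c) ⟩
    diffs (block ++ window (suc k) c)
      ≡⟨ cong (diffs ∘ (block ++_)) (window-∷ (suc k) c) ⟩
    diffs (block ++ suc (suc k * N) ∷ rest)
      ≡⟨ diffs-++ block (suc (suc k * N)) rest ⟩
    diffs (block ∷ʳ suc (suc k * N)) ++ diffs (suc (suc k * N) ∷ rest)
      ≡⟨ cong₂ _++_ (cong diffs (block-∷ʳ k)) (cong diffs (sym (window-∷ (suc k) c))) ⟩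
    diffs (map (k * N +_) period) ++ diffs (window (suc k) c)
      ≡⟨ cong₂ _++_ (diffs-map-+ (k * N) period) (diffs-window c (suc k)) ⟩
    diffs period ++ copies c (diffs period)
      ∎
    where
    block rest : List ℕ
    block = filter P? (range (suc (k * N)) N)
    rest  = filter P? (range (2 + suc k * N) (c * N))

  scanl-copies : ∀ c → scanl _+_ 1 (copies c (diffs period)) ≡ window 0 c
  scanl-copies c = begin
    scanl _+_ 1 (copies c (diffs period))
      ≡⟨ cong (scanl _+_ 1) (sym (diffs-window c 0)) ⟩
    scanl _+_ 1 (diffs (window 0 c))
      ≡⟨ cong (scanl _+_ 1 ∘ diffs) (window-∷ 0 c) ⟩
    scanl _+_ 1 (diffs (1 ∷ rest))
      ≡⟨ scanl-diffs (subst Increasing (window-∷ 0 c) (window-increasing 0 c)) ⟩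
    1 ∷ rest
      ≡⟨ sym (window-∷ 0 c) ⟩
    window 0 c
      ∎
    where
    rest : List ℕ
    rest = filter P? (range 2 (c * N))

-- Coprimality and primorials

prime>1 : ∀ {q} → Prime q → 1 < q
prime>1 {q} q-prime = nonTrivial⇒n>1 q ⦃ prime⇒nonTrivial q-prime ⦄

prime∤1 : ∀ {q} → Prime q → q ∤ 1
prime∤1 q-prime q∣1 = ¬prime[1] (subst Prime (∣1⇒≡1 q∣1) q-prime)

prime∤1+* : ∀ {q} n → Prime q → q ∤ suc (q * n)
prime∤1+* {q} n q-prime q∣1+qn = prime∤1 q-prime (∣m+n∣m⇒∣n (subst (q ∣_) (+-comm 1 (q * n)) q∣1+qn) (m∣m*n n))

module _ {N : ℕ} where

  coprime-*+⁻ : ∀ k {x} → Coprime (k * N + x) N → Coprime x N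
  coprime-*+⁻ k c (d∣x , d∣N) = c (∣m∣n⇒∣m+n (∣n⇒∣m*n k d∣N) d∣x , d∣N)

  coprime-*+⁺ : ∀ k {x} → Coprime x N → Coprime (k * N + x) N
  coprime-*+⁺ k c (d∣kN+x , d∣N) = c (∣m+n∣m⇒∣n d∣kN+x (∣n⇒∣m*n k d∣N) , d∣N)

  coprime-*⁻ : ∀ q {u} → Coprime (q * u) N → Coprime u N
  coprime-*⁻ q c (d∣u , d∣N) = c (∣n⇒∣m*n q d∣u , d∣N)

  coprime-*⁺ : ∀ {q u} → Coprime q N → Coprime u N → Coprime (q * u) N
  coprime-*⁺ {q} {u} q⊥N u⊥N {d} (d∣qu , d∣N) = u⊥N (coprime-divisor d⊥q d∣qu , d∣N)
    where
    d⊥q : Coprime d q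
    d⊥q (e∣d , e∣q) = q⊥N (e∣q , ∣-trans e∣d d∣N)

  coprime-prime*⁻ : ∀ {q x} → Prime q → Coprime x (q * N) → Coprime x N × q ∤ x
  coprime-prime*⁻ {q} q-prime c = (λ (d∣x , d∣N) → c (d∣x , ∣n⇒∣m*n q d∣N))
                                , (λ q∣x → prime∤1 q-prime (subst (q ∣_) (c (q∣x , m∣m*n N)) ∣-refl))

  coprime-prime*⁺ : ∀ {q x} → Prime q → Coprime x N → q ∤ x → Coprime x (q * N)
  coprime-prime*⁺ {q} q-prime x⊥N q∤x {d} (d∣x , d∣qN) = x⊥N (d∣x , coprime-divisor d⊥q d∣qN)
    where
    d⊥q : Coprime d q
    d⊥q (e∣d , e∣q) with prime⇒irreducible q-prime e∣q
    ... | inj₁ e≡1 = e≡1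
    ... | inj₂ refl = ⊥-elim (q∤x (∣-trans e∣d d∣x))

prime∣primorial : ∀ {r p} → Prime r → r ≤ p → r ∣ primorial p
prime∣primorial r-prime r≤p = ∈⇒∣product (∈-filter⁺ prime? (∈-upTo⁺ (s≤s r≤p)) r-prime)

prime∣primorial⇒≤ : ∀ {r p} → Prime r → r ∣ primorial p → r ≤ p
prime∣primorial⇒≤ {r} {p} r-prime r∣p# = ≤-pred (∈-upTo⁻ (proj₁ (∈-filter⁻ prime? {xs = upTo (suc p)}
  (factorisationHasAllPrimeFactors r-prime r∣p# (all-filter prime? (upTo (suc p)))))))

∃prime∣ : ∀ {x} → 1 < x → ∃[ r ] Prime r × r ∣ x
∃prime∣ {x} 1<x with factorise x ⦃ >-nonZero (<-trans z<s 1<x) ⦄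
... | record { factors = [] ; isFactorisation = x≡1 } = ⊥-elim (<⇒≢ 1<x (sym x≡1))
... | record { factors = r ∷ rs ; isFactorisation = x≡r*rs ; factorsPrime = r-prime ∷ _ } =
  r , r-prime , subst (r ∣_) (sym x≡r*rs) (m∣m*n (product rs))

primorial-suc : ∀ n → primorial (suc n) ≡ primorial n * product (filter prime? (suc n ∷ []))
primorial-suc n = begin
  product (filter prime? (upTo (suc (suc n))))
    ≡⟨ cong (product ∘ filter prime?) (sym (upTo-∷ʳ (suc n))) ⟩
  product (filter prime? (upTo (suc n) ∷ʳ suc n))
    ≡⟨ cong product (filter-++ prime? (upTo (suc n)) _) ⟩
  product (filter prime? (upTo (suc n)) ++ filter prime? (suc n ∷ []))
    ≡⟨ product-++ (filter prime? (upTo (suc n))) _ ⟩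
  primorial n * product (filter prime? (suc n ∷ []))
    ∎

primorial-suc-prime : ∀ {n} → Prime (suc n) → primorial (suc n) ≡ suc n * primorial n
primorial-suc-prime {n} n+1-prime = begin
  primorial (suc n)
    ≡⟨ primorial-suc n ⟩
  primorial n * product (filter prime? (suc n ∷ []))
    ≡⟨ cong (λ xs → primorial n * product xs) (filter-accept prime? n+1-prime) ⟩
  primorial n * (suc n * 1)
    ≡⟨ cong (primorial n *_) (*-identityʳ (suc n)) ⟩
  primorial n * suc n
    ≡⟨ *-comm (primorial n) (suc n) ⟩
  suc n * primorial n
    ∎

primorial-suc-¬prime : ∀ {n} → ¬ Prime (suc n) → primorial (suc n) ≡ primorial n
primorial-suc-¬prime {n} n+1-nonprime = begin
  primorial (suc n)
    ≡⟨ primorial-suc n ⟩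
  primorial n * product (filter prime? (suc n ∷ []))
    ≡⟨ cong (λ xs → primorial n * product xs) (filter-reject prime? n+1-nonprime) ⟩
  primorial n * 1
    ≡⟨ *-identityʳ (primorial n) ⟩
  primorial n
    ∎

primorial-+ : ∀ p k → (∀ r → p < r → r ≤ p + k → ¬ Prime r) → primorial (p + k) ≡ primorial p
primorial-+ p zero    _   = cong primorial (+-identityʳ p)
primorial-+ p (suc k) gap = begin
  primorial (p + suc k)
    ≡⟨ cong primorial (+-suc p k) ⟩
  primorial (suc (p + k))
    ≡⟨ primorial-suc-¬prime (gap (suc (p + k)) (s≤s (m≤m+n p k)) (≤-reflexive (sym (+-suc p k)))) ⟩
  primorial (p + k)
    ≡⟨ primorial-+ p k (λ r p<r r≤p+k → gap r p<r (≤-trans r≤p+k (+-monoʳ-≤ p (n≤1+n k)))) ⟩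
  primorial p
    ∎

primorial-nextPrime : ∀ {p q} → Prime q → p < q → (∀ r → p < r → r < q → ¬ Prime r) → primorial q ≡ q * primorial p
primorial-nextPrime {p} {suc m} q-prime (s≤s p≤m) gap = begin
  primorial (suc m)
    ≡⟨ primorial-suc-prime q-prime ⟩
  suc m * primorial m
    ≡⟨ cong (λ n → suc m * primorial n) (sym (m+[n∸m]≡n p≤m)) ⟩
  suc m * primorial (p + (m ∸ p))
    ≡⟨ cong (suc m *_) (primorial-+ p (m ∸ p) (λ r p<r r≤m → gap r p<r (s≤s (subst (r ≤_) (m+[n∸m]≡n p≤m) r≤m)))) ⟩
  suc m * primorial p
    ∎

nextPrime-coprime-primorial : ∀ {p q} → Prime q → p < q → Coprime q (primorial p)
nextPrime-coprime-primorial q-prime p<q (d∣q , d∣p#) with prime⇒irreducible q-prime d∣q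
... | inj₁ d≡1 = d≡1
... | inj₂ refl = ⊥-elim (<⇒≱ p<q (prime∣primorial⇒≤ q-prime d∣p#))

below-nextPrime-¬coprime-primorial : ∀ {p q} → (∀ r → p < r → r < q → ¬ Prime r) →
  ∀ {x} → 1 < x → x < q → ¬ Coprime x (primorial p)
below-nextPrime-¬coprime-primorial {p} gap {x} 1<x x<q x⊥p# with r , r-prime , r∣x ← ∃prime∣ 1<x with r ≤? p
... | yes r≤p = prime∤1 r-prime (subst (r ∣_) (x⊥p# (r∣x , prime∣primorial r-prime r≤p)) ∣-refl)
... | no  r≰p = gap r (≰⇒> r≰p) (≤-<-trans (∣⇒≤ ⦃ >-nonZero (<-trans z<s 1<x) ⦄ r∣x) x<q) r-prime

primorial-nonZero : ∀ p → NonZero (primorial p)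
primorial-nonZero p = productOfPrimes≢0 (all-filter prime? (upTo (suc p)))

-- Gaps of N and of qN

module _ {N : ℕ} where

  private
    P? : Decidable (λ u → Coprime u N)
    P? u = coprime? u N

  open Periodic P? N (λ k → coprime-*+⁻ k , coprime-*+⁺ k) (1-coprimeTo N)

  gapCycle≡diffs-period : gapCycle N ≡ diffs period
  gapCycle≡diffs-period = cong (diffs ∘ filter P?) (applyUpTo-suc (suc N))

  scanl-copies-gapCycle : ∀ c → scanl _+_ 1 (copies c (gapCycle N)) ≡ coprimesIn N (c * N + 1)
  scanl-copies-gapCycle c = begin
    scanl _+_ 1 (copies c (gapCycle N))     ≡⟨ cong (scanl _+_ 1 ∘ copies c) gapCycle≡diffs-period ⟩
    scanl _+_ 1 (copies c (diffs period))   ≡⟨ scanl-copies c ⟩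
    filter P? (range 1 (suc (c * N)))       ≡⟨ cong (filter P? ∘ range 1) (+-comm 1 (c * N)) ⟩
    filter P? (range 1 (c * N + 1))         ≡⟨ cong (filter P?) (sym (applyUpTo-suc (c * N + 1))) ⟩
    coprimesIn N (c * N + 1)                ∎

  module _ {q} (q-prime : Prime q) (q⊥N : Coprime q N) ⦃ _ : NonZero N ⦄ where

    private
      instance
        q≢0 : NonZero q
        q≢0 = prime⇒nonZero q-prime

      ∤q? : Decidable (q ∤_)
      ∤q? = ∁? (q ∣?_)

      0<qN : 0 < q * N
      0<qN = *-mono-≤ (>-nonZero⁻¹ q) (>-nonZero⁻¹ N)

      interior : List ℕ
      interior = filter P? (range 2 (pred (q * N)))

      window-q : window 0 q ≡ 1 ∷ interior ∷ʳ suc (q * N)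
      window-q = trans (window-∷ʳ q) (cong (_∷ʳ suc (q * N)) (filter-range-1 0<qN))

      window-q-increasing : Increasing (1 ∷ interior ∷ʳ suc (q * N))
      window-q-increasing = subst Increasing window-q (window-increasing 0 q)

      copies-gapCycle : copies q (gapCycle N) ≡ diffs (1 ∷ interior ∷ʳ suc (q * N))
      copies-gapCycle = begin
        copies q (gapCycle N)     ≡⟨ cong (copies q) gapCycle≡diffs-period ⟩
        copies q (diffs period)   ≡⟨ sym (diffs-window q 0) ⟩
        diffs (window 0 q)        ≡⟨ cong diffs window-q ⟩
        diffs (1 ∷ interior ∷ʳ suc (q * N)) ∎

    head-gapCycle : (∀ {x} → 1 < x → x < q → ¬ Coprime x N) → head (gapCycle N) ≡ just (q ∸ 1)
    head-gapCycle least = cong (head ∘ diffs) (begin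
      filter P? (applyUpTo suc (suc N))  ≡⟨ cong (filter P?) (applyUpTo-suc (suc N)) ⟩
      filter P? (1 ∷ range 2 N)          ≡⟨ filter-accept P? (1-coprimeTo N) ⟩
      1 ∷ filter P? (range 2 N)          ≡⟨ cong (1 ∷_) (proj₂ first) ⟩
      1 ∷ q ∷ proj₁ first                ∎)
      where
      q≤1+N : q ≤ suc N
      q≤1+N with q ≤? suc N
      ... | yes q≤1+N = q≤1+N
      ... | no  q≰1+N = ⊥-elim (least (s≤s (>-nonZero⁻¹ N)) (≰⇒> q≰1+N)
                                      (subst (λ n → Coprime n N) (+-comm N 1) (coprime-+ (1-coprimeTo N))))
      first : ∃[ t ] filter P? (range 2 N) ≡ q ∷ t
      first = filter-range-least P? N (prime>1 q-prime) (s≤s q≤1+N) q⊥N least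

    close-copies-gapCycle : close q (copies q (gapCycle N)) ≡ gapCycle (q * N)
    close-copies-gapCycle = begin
      close q (copies q (gapCycle N))
        ≡⟨ cong (close q) copies-gapCycle ⟩
      close q (diffs (1 ∷ interior ∷ʳ suc (q * N)))
        ≡⟨ close-diffs q interior (suc (q * N)) window-q-increasing (prime∤1 q-prime) (prime∤1+* N q-prime) ⟩
      diffs (filter ∤q? (1 ∷ interior ∷ʳ suc (q * N)))
        ≡⟨ cong (diffs ∘ filter ∤q?) (sym window-q) ⟩
      diffs (filter ∤q? (filter P? (range 1 (suc (q * N)))))
        ≡⟨ cong diffs (sym (filter-∩ P? ∤q? (range 1 (suc (q * N))))) ⟩
      diffs (filter (P? ∩? ∤q?) (range 1 (suc (q * N))))
        ≡⟨ cong diffs (sym (filter-≐ (λ u → coprime? u (q * N)) (P? ∩? ∤q?) coprime[qN]≐ (range 1 (suc (q * N))))) ⟩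
      diffs (filter (λ u → coprime? u (q * N)) (range 1 (suc (q * N))))
        ≡⟨ cong (diffs ∘ filter (λ u → coprime? u (q * N))) (sym (applyUpTo-suc (suc (q * N)))) ⟩
      gapCycle (q * N)
        ∎
      where
      coprime[qN]≐ : (λ x → Coprime x (q * N)) ≐ (λ x → Coprime x N × q ∤ x)
      coprime[qN]≐ = coprime-prime*⁻ q-prime , λ (x⊥N , q∤x) → coprime-prime*⁺ q-prime x⊥N q∤x

    multiples-coprimes : filter (q ∣?_) (filter P? (range 1 (q * N))) ≡ map (q *_) (filter P? (range 1 N))
    multiples-coprimes = increasing-≡
      (AllPairsₚ.filter⁺ (q ∣?_) (AllPairsₚ.filter⁺ P? (range-increasing 1 (q * N))))
      (AllPairsₚ.map⁺ (AllPairs.map (*-monoʳ-< q) (AllPairsₚ.filter⁺ P? (range-increasing 1 N))))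
      ⊆ ⊇
      where
      multiple⁻ : ∀ {u} → u * q ∈ filter P? (range 1 (q * N)) → u ∈ filter P? (range 1 N)
      multiple⁻ {zero} uq∈ with () ← proj₁ (∈-range⁻ 1 (q * N) (proj₁ (∈-filter⁻ P? uq∈)))
      multiple⁻ {suc u} uq∈ with uq∈range , uq⊥N ← ∈-filter⁻ P? uq∈ with _ , uq<1+qN ← ∈-range⁻ 1 (q * N) uq∈range =
        ∈-filter⁺ P? (∈-range⁺ 1 N (s≤s z≤n) (s≤s (*-cancelˡ-≤ q (subst (_≤ q * N) (*-comm (suc u) q) (≤-pred uq<1+qN)))))
                     (coprime-*⁻ q (subst (λ n → Coprime n N) (*-comm (suc u) q) uq⊥N))
      multiple⁺ : ∀ {u} → u ∈ filter P? (range 1 N) → q * u ∈ filter P? (range 1 (q * N))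
      multiple⁺ u∈ with u∈range , u⊥N ← ∈-filter⁻ P? u∈ with 1≤u , u<1+N ← ∈-range⁻ 1 N u∈range =
        ∈-filter⁺ P? (∈-range⁺ 1 (q * N) (*-mono-≤ (>-nonZero⁻¹ q) 1≤u) (s≤s (*-monoʳ-≤ q (≤-pred u<1+N))))
                     (coprime-*⁺ q⊥N u⊥N)
      ⊆ : ∀ {z} → z ∈ filter (q ∣?_) (filter P? (range 1 (q * N))) → z ∈ map (q *_) (filter P? (range 1 N))
      ⊆ z∈ with z∈W , divides u refl ← ∈-filter⁻ (q ∣?_) {xs = filter P? (range 1 (q * N))} z∈ =
        subst (_∈ map (q *_) (filter P? (range 1 N))) (*-comm q u) (∈-map⁺ (q *_) (multiple⁻ z∈W))
      ⊇ : ∀ {z} → z ∈ map (q *_) (filter P? (range 1 N)) → z ∈ filter (q ∣?_) (filter P? (range 1 (q * N)))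
      ⊇ z∈ with u , u∈ , refl ← ∈-map⁻ (q *_) z∈ = ∈-filter⁺ (q ∣?_) (multiple⁺ u∈) (m∣m*n u)

    closureValues-copies-gapCycle : closureValues q (copies q (gapCycle N)) ≡ map (q *_) (coprimesIn N N)
    closureValues-copies-gapCycle = begin
      closureValues q (copies q (gapCycle N))
        ≡⟨ cong (closureValues q) copies-gapCycle ⟩
      closureValues q (diffs (1 ∷ interior ∷ʳ suc (q * N)))
        ≡⟨ closureValues-diffs q interior (suc (q * N)) window-q-increasing (prime∤1 q-prime) ⟩
      filter (q ∣?_) (1 ∷ interior)
        ≡⟨ cong (filter (q ∣?_)) (sym (filter-range-1 0<qN)) ⟩
      filter (q ∣?_) (filter P? (range 1 (q * N)))
        ≡⟨ multiples-coprimes ⟩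
      map (q *_) (filter P? (range 1 N))
        ≡⟨ cong (map (q *_) ∘ filter P?) (sym (applyUpTo-suc N)) ⟩
      map (q *_) (coprimesIn N N)
        ∎

    diffs-closureValues : ∃[ g ] diffs (closureValues q (copies q (gapCycle N))) ∷ʳ g ≡ map (q *_) (gapCycle N)
    diffs-closureValues = subst₂ (λ xs ys → ∃[ g ] diffs xs ∷ʳ g ≡ map (q *_) ys)
      (sym (trans closureValues-copies-gapCycle (cong (map (q *_)) F≡)))
      (sym (trans gapCycle≡diffs-period (cong diffs (trans period-∷ʳ (cong (_∷ʳ suc N) (filter-range-1 (>-nonZero⁻¹ N)))))))
      (diffs-map-*-∷ʳ q 1 rest (suc N))
      where
      rest : List ℕ
      rest = filter P? (range 2 (pred N))
      F≡ : coprimesIn N N ≡ 1 ∷ rest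
      F≡ = trans (cong (filter P?) (applyUpTo-suc N)) (filter-range-1 (>-nonZero⁻¹ N))

mainTheorem1 : (p q : ℕ) → Prime p → Prime q → p < q →
    (∀ r → p < r → r < q → ¬ Prime r) →
    (∃[ g₁ ] (head (gapCycle (primorial p)) ≡ just g₁ × q ≡ g₁ + 1))
    × (scanl _+_ 1 (copies q (gapCycle (primorial p)))
         ≡ coprimesIn (primorial p) (primorial q + 1))
    × (close q (copies q (gapCycle (primorial p))) ≡ gapCycle (primorial q))
    × (closureValues q (copies q (gapCycle (primorial p)))
         ≡ map (q *_) (coprimesIn (primorial p) (primorial p)))
    × (∃[ g ] (diffs (closureValues q (copies q (gapCycle (primorial p)))) ++ g ∷ []
         ≡ map (q *_) (gapCycle (primorial p))))
mainTheorem1 p q _ q-prime p<q gap rewrite primorial-nextPrime q-prime p<q gap =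
    (q ∸ 1 , head-gapCycle q-prime q⊥p# (below-nextPrime-¬coprime-primorial gap)
           , sym (m∸n+n≡m (<⇒≤ (prime>1 q-prime))))
  , scanl-copies-gapCycle q
  , close-copies-gapCycle q-prime q⊥p#
  , closureValues-copies-gapCycle q-prime q⊥p#
  , diffs-closureValues q-prime q⊥p#
  where
  instance
    p#≢0 : NonZero (primorial p)
    p#≢0 = primorial-nonZero p
  q⊥p# : Coprime q (primorial p)
  q⊥p# = nextPrime-coprime-primorial q-prime p<q
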